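{- Let $n$ be a positive integer, $j$ an integer with $0\le j\le n$, and $m$ a positive integer with $m\ge 2n$. Let $Schr(n,m,j,2)$ denote the number of lattice paths in the plane from $(0,0)$ to $(n,m)$, using steps $(1,0)$, $(0,1)$ and $(1,1)$, that never go below the line $y=2x$ (i.e. every lattice point $(x,y)$ on the path satisfies $y\ge 2x$) and that use exactly $j$ steps of the form $(1,0)$. Then \[ Schr(n,m,j,2)=\frac{m-2n+1}{n}\binom{n}{j}\binom{m+j}{n-1}. \] -}

module Defs where

open import Data.Nat using (ℕ; zero; suc; _+_; _*_; _≤_)
open import Data.List using (List; []; _∷_; length; filter)
open import Data.List.Relation.Unary.All using (All)
open import Data.Product using (_×_; Σ)
open import Relation.Binary.PropositionalEquality using (_≡_)

data Step : Set where
  E : Step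
  N : Step
  D : Step

Point : Set
Point = ℕ × ℕ

open import Data.Product using (_,_)

move : Point → Step → Point
move (x , y) E = (suc x , y)
move (x , y) N = (x , suc y)
move (x , y) D = (suc x , suc y)

points : Point → List Step → List Point
points p []       = p ∷ []
points p (s ∷ ss) = p ∷ points (move p s) ss

endpoint : Point → List Step → Point
endpoint p []       = p
endpoint p (s ∷ ss) = endpoint (move p s) ss

Above : Point → Set
Above (x , y) = 2 * x ≤ y

countE : List Step → ℕ
countE []       = 0
countE (E ∷ ss) = suc (countE ss)
countE (N ∷ ss) = countE ss
countE (D ∷ ss) = countE ss

IsSchrPath : ℕ → ℕ → ℕ → List Step → Set
IsSchrPath n m j ss =
  (endpoint (0 , 0) ss ≡ (n , m)) × All Above (points (0 , 0) ss) × (countE ss ≡ j)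

SchrPath : ℕ → ℕ → ℕ → Set
SchrPath n m j = Σ (List Step) (IsSchrPath n m j)

{-# OPTIONS --safe #-}
module Submission where

-- Sorting paths by their last step gives, at every lattice point (x, y) with y ≥ 2x,
--   Schr(x, y, j) = Schr(x-1, y, j-1) + Schr(x, y-1, j) + Schr(x-1, y-1, j),
-- while Schr vanishes just below the line. Writing m = 2n + k, the claim
-- n Schr(n, m, j) = (k+1) C(n, j) C(m+j, n-1) then follows by induction on n and k:
-- multiplied by n - 1, the recurrence becomes a polynomial identity modulo two instances
-- of the absorption identity j C(n, j) = n C(n-1, j-1). The paths themselves are listed
-- without repetition along the same recurrence, which makes the count a cardinality.

open import Defs
open import Data.Nat using (ℕ; _+_; _*_; _∸_; _≤_)
open import Data.Nat.Combinatorics using (_C_)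
open import Data.Fin using (Fin)
open import Data.Product using (Σ; _×_)
open import Function.Bundles using (_↔_)
open import Relation.Binary.PropositionalEquality using (_≡_)

open import Data.Nat using (zero; suc; _<_; _≤?_; z≤n; s≤s)
open import Data.Nat.Properties
  using (+-identityʳ; +-suc; +-comm; +-assoc; *-zeroʳ; *-identityʳ; *-distribˡ-+;
         suc-injective; +-cancelʳ-≡; *-cancelˡ-≡; ≤-reflexive; ≤-trans; m≤m+n;
         <⇒≱; ≤-irrelevant; m≤n⇒∃[o]m+o≡n; m+n∸m≡n)
open import Data.Nat.Combinatorics using (nCk+nC[k+1]≡[n+1]C[k+1])
open import Data.Nat.Tactic.RingSolver using (solve-∀)
open import Data.Product using (_,_; proj₁; proj₂)
open import Data.Sum using (inj₁; inj₂)
open import Data.Fin using (zero; suc)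
open import Data.List using (List; []; _∷_; _∷ʳ_; _++_; map; length; lookup)
open import Data.List.Properties using (length-++; length-map; ∷ʳ-injectiveˡ; ∷ʳ-injectiveʳ)
open import Data.List.Relation.Unary.All as All using (All; []; _∷_)
open import Data.List.Relation.Unary.All.Properties using (map⁺; ++⁺; ∷ʳ⁺; ∷ʳ⁻)
open import Data.List.Relation.Unary.Any using (here; index)
open import Data.List.Relation.Unary.Any.Properties using (lookup-index)
open import Data.List.Relation.Unary.AllPairs using ([]; _∷_)
open import Data.List.Relation.Unary.Unique.Propositional using (Unique)
import Data.List.Relation.Unary.Unique.Propositional.Properties as Unique
open import Data.List.Relation.Binary.Disjoint.Propositional using (Disjoint)
open import Data.List.Membership.Propositional using (_∈_)
open import Data.List.Membership.Propositional.Properties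
  using (∈-map⁺; ∈-map⁻; ∈-++⁺ˡ; ∈-++⁺ʳ; ∈-++⁻; ∈-lookup)
open import Data.List.Membership.Propositional.Properties.WithK using (unique⇒irrelevant)
open import Data.List.Reverse using (Reverse; reverseView; []; _∶_∶ʳ_)
open import Function.Bundles using (mk↔ₛ′)
open import Relation.Nullary using (¬_; yes; no; contradiction)
open import Relation.Nullary.Irrelevant using (Irrelevant)
open import Relation.Binary.PropositionalEquality
  using (refl; sym; trans; cong; cong₂; subst; subst₂; module ≡-Reasoning)
open import Relation.Binary.PropositionalEquality.WithK using (≡-irrelevant)

open ≡-Reasoning

-- shift z f j is f (j - 1), and z at j = 0; thus shift 0 (n C_) j is C(n, j-1), unlike n C (j ∸ 1).
shift : {A : Set} → A → (ℕ → A) → ℕ → A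
shift z f zero    = z
shift z f (suc j) = f j

shift-cong : ∀ {A : Set} {z : A} {f g : ℕ → A} → (∀ i → f i ≡ g i) →
             ∀ j → shift z f j ≡ shift z g j
shift-cong f≗g zero    = refl
shift-cong f≗g (suc j) = f≗g j

pascal : ∀ n j → suc n C j ≡ shift 0 (n C_) j + n C j
pascal n zero    = refl
pascal n (suc j) = sym (nCk+nC[k+1]≡[n+1]C[k+1] n j)

absorption : ∀ n j → j * (suc n C j) ≡ suc n * shift 0 (n C_) j
absorption n       zero          = sym (*-zeroʳ (suc n))
absorption zero    (suc zero)    = refl
absorption zero    (suc (suc j)) = *-zeroʳ (suc (suc j))
absorption (suc n) (suc j)       = begin
    suc j * (suc (suc n) C suc j)
  ≡⟨ cong (suc j *_) (pascal (suc n) (suc j)) ⟩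
    suc j * (suc n C j + suc n C suc j)
  ≡⟨ *-distribˡ-+ (suc j) (suc n C j) (suc n C suc j) ⟩
    suc j * (suc n C j) + suc j * (suc n C suc j)
  ≡⟨ cong₂ _+_ (cong (suc n C j +_) (absorption n j)) (absorption n (suc j)) ⟩
    suc n C j + suc n * shift 0 (n C_) j + suc n * (n C j)
  ≡⟨ +-assoc (suc n C j) _ _ ⟩
    suc n C j + (suc n * shift 0 (n C_) j + suc n * (n C j))
  ≡⟨ cong (suc n C j +_) (sym (*-distribˡ-+ (suc n) _ (n C j))) ⟩
    suc n C j + suc n * (shift 0 (n C_) j + n C j)
  ≡⟨ cong (λ c → suc n C j + suc n * c) (sym (pascal n j)) ⟩
    suc (suc n) * (suc n C j)
  ∎

index-∈-lookup : ∀ {A : Set} (xs : List A) i → index (∈-lookup {xs = xs} i) ≡ i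
index-∈-lookup (x ∷ xs) zero    = refl
index-∈-lookup (x ∷ xs) (suc i) = cong suc (index-∈-lookup xs i)

Fin-length↔Σ : ∀ {A : Set} {P : A → Set} {xs : List A} → Unique xs → (∀ {z} → Irrelevant (P z)) →
              All P xs → (∀ {z} → P z → z ∈ xs) → Fin (length xs) ↔ Σ A P
Fin-length↔Σ {A} {P} {xs} unique P-irrelevant sound complete = mk↔ₛ′ to from to-from from-to
  where
  to : Fin (length xs) → Σ A P
  to i = lookup xs i , All.lookup sound (∈-lookup i)

  from : Σ A P → Fin (length xs)
  from (z , p) = index (complete p)

  Σ-≡ : ∀ {z w} → z ≡ w → (p : P z) (q : P w) → (z , p) ≡ (w , q)
  Σ-≡ refl p q = cong (_ ,_) (P-irrelevant p q)

  to-from : ∀ zp → to (from zp) ≡ zp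
  to-from (z , p) = Σ-≡ (sym (lookup-index (complete p))) _ p

  from-to : ∀ i → from (to i) ≡ i
  from-to i = trans (cong index (unique⇒irrelevant unique _ _)) (index-∈-lookup xs i)

map-∷ʳ-unique : ∀ {A : Set} (a : A) {xss : List (List A)} → Unique xss → Unique (map (_∷ʳ a) xss)
map-∷ʳ-unique a = Unique.map⁺ (λ {xs} {ys} → ∷ʳ-injectiveˡ xs ys)

map-∷ʳ-disjoint : ∀ {A : Set} {a b : A} → ¬ a ≡ b → (xss yss : List (List A)) →
                  Disjoint (map (_∷ʳ a) xss) (map (_∷ʳ b) yss)
map-∷ʳ-disjoint a≢b xss yss (∈xss , ∈yss) with ∈-map⁻ (_∷ʳ _) ∈xss | ∈-map⁻ (_∷ʳ _) ∈yss
... | xs , _ , refl | ys , _ , eq = a≢b (∷ʳ-injectiveʳ xs ys eq)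

disjoint-++ : ∀ {A : Set} {xs ys zs : List A} → Disjoint xs ys → Disjoint xs zs → Disjoint xs (ys ++ zs)
disjoint-++ {ys = ys} xs#ys xs#zs (∈xs , ∈ys++zs) with ∈-++⁻ ys ∈ys++zs
... | inj₁ ∈ys = xs#ys (∈xs , ∈ys)
... | inj₂ ∈zs = xs#zs (∈xs , ∈zs)

endpoint-∷ʳ : ∀ p ss s → endpoint p (ss ∷ʳ s) ≡ move (endpoint p ss) s
endpoint-∷ʳ p []       s = refl
endpoint-∷ʳ p (t ∷ ss) s = endpoint-∷ʳ (move p t) ss s

points-∷ʳ : ∀ p ss s → points p (ss ∷ʳ s) ≡ points p ss ∷ʳ move (endpoint p ss) s
points-∷ʳ p []       s = refl
points-∷ʳ p (t ∷ ss) s = cong (p ∷_) (points-∷ʳ (move p t) ss s)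

countE-∷ʳ : ∀ ss s → countE (ss ∷ʳ s) ≡ countE (s ∷ []) + countE ss
countE-∷ʳ []       E = refl
countE-∷ʳ []       N = refl
countE-∷ʳ []       D = refl
countE-∷ʳ (E ∷ ss) s = trans (cong suc (countE-∷ʳ ss s)) (sym (+-suc (countE (s ∷ [])) (countE ss)))
countE-∷ʳ (N ∷ ss) s = countE-∷ʳ ss s
countE-∷ʳ (D ∷ ss) s = countE-∷ʳ ss s

IsSchrPath-∷ʳ : ∀ {x y j ss} s → Above (move (x , y) s) → IsSchrPath x y j ss →
  IsSchrPath (proj₁ (move (x , y) s)) (proj₂ (move (x , y) s)) (countE (s ∷ []) + j) (ss ∷ʳ s)
IsSchrPath-∷ʳ {ss = ss} s above (refl , all-above , refl) =
  endpoint-∷ʳ (0 , 0) ss s ,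
  subst (All Above) (sym (points-∷ʳ (0 , 0) ss s)) (∷ʳ⁺ all-above above) ,
  countE-∷ʳ ss s

IsSchrPath-irrelevant : ∀ {x y j ss} → Irrelevant (IsSchrPath x y j ss)
IsSchrPath-irrelevant (e₁ , a₁ , c₁) (e₂ , a₂ , c₂) =
  cong₂ _,_ (≡-irrelevant e₁ e₂)
            (cong₂ _,_ (All.irrelevant ≤-irrelevant a₁ a₂) (≡-irrelevant c₁ c₂))

-- Only the endpoint is tested against the line: the earlier points are those of a path
-- produced by a recursive call.
paths : ℕ → ℕ → ℕ → List (List Step)
paths zero    zero    zero    = [] ∷ []
paths zero    zero    (suc j) = []
paths zero    (suc y) j       = map (_∷ʳ N) (paths zero y j)
paths (suc x) zero    j       = []
paths (suc x) (suc y) j with 2 * suc x ≤? suc y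
... | yes _ = map (_∷ʳ E) (shift [] (paths x (suc y)) j)
           ++ map (_∷ʳ N) (paths (suc x) y j)
           ++ map (_∷ʳ D) (paths x y j)
... | no  _ = []

schr : ℕ → ℕ → ℕ → ℕ
schr x y j = length (paths x y j)

map-∷ʳ-IsSchrPath : ∀ {x y j sss} s → Above (move (x , y) s) → All (IsSchrPath x y j) sss →
  All (IsSchrPath (proj₁ (move (x , y) s)) (proj₂ (move (x , y) s)) (countE (s ∷ []) + j))
      (map (_∷ʳ s) sss)
map-∷ʳ-IsSchrPath s above ps = map⁺ (All.map (IsSchrPath-∷ʳ s above) ps)

paths-sound : ∀ x y j → All (IsSchrPath x y j) (paths x y j)
paths-sound zero    zero    zero    = (refl , z≤n ∷ [] , refl) ∷ []
paths-sound zero    zero    (suc j) = []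
paths-sound zero    (suc y) j       = map-∷ʳ-IsSchrPath N z≤n (paths-sound zero y j)
paths-sound (suc x) zero    j       = []
paths-sound (suc x) (suc y) j with 2 * suc x ≤? suc y
... | no  _     = []
... | yes above = ++⁺ (last-E j) (++⁺ (map-∷ʳ-IsSchrPath N above (paths-sound (suc x) y j))
                                       (map-∷ʳ-IsSchrPath D above (paths-sound x y j)))
  where
  last-E : ∀ j → All (IsSchrPath (suc x) (suc y) j) (map (_∷ʳ E) (shift [] (paths x (suc y)) j))
  last-E zero    = []
  last-E (suc j) = map-∷ʳ-IsSchrPath E above (paths-sound x (suc y) j)

∈-paths-∷ʳ : ∀ {x y j ss} s → Above (move (x , y) s) → ss ∈ paths x y j →
  ss ∷ʳ s ∈ paths (proj₁ (move (x , y) s)) (proj₂ (move (x , y) s)) (countE (s ∷ []) + j)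
∈-paths-∷ʳ {x} {zero}  E () _
∈-paths-∷ʳ {x} {suc y} E above ∈ss with 2 * suc x ≤? suc y
... | yes _      = ∈-++⁺ˡ (∈-map⁺ (_∷ʳ E) ∈ss)
... | no  ¬above = contradiction above ¬above
∈-paths-∷ʳ {zero}          N above ∈ss = ∈-map⁺ (_∷ʳ N) ∈ss
∈-paths-∷ʳ {suc x} {y} {j} N above ∈ss with 2 * suc x ≤? suc y
... | yes _      = ∈-++⁺ʳ (map (_∷ʳ E) (shift [] (paths x (suc y)) j)) (∈-++⁺ˡ (∈-map⁺ (_∷ʳ N) ∈ss))
... | no  ¬above = contradiction above ¬above
∈-paths-∷ʳ {x} {y} {j}     D above ∈ss with 2 * suc x ≤? suc y
... | yes _      = ∈-++⁺ʳ (map (_∷ʳ E) (shift [] (paths x (suc y)) j))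
                     (∈-++⁺ʳ (map (_∷ʳ N) (paths (suc x) y j)) (∈-map⁺ (_∷ʳ D) ∈ss))
... | no  ¬above = contradiction above ¬above

paths-complete : ∀ {x y j ss} → IsSchrPath x y j ss → ss ∈ paths x y j
paths-complete {ss = ss} = go (reverseView ss)
  where
  go : ∀ {x y j ss} → Reverse ss → IsSchrPath x y j ss → ss ∈ paths x y j
  go []            (refl , _ , refl)         = here refl
  go (ss ∶ r ∶ʳ s) (refl , all-above , refl) =
    subst₂ (λ p c → ss ∷ʳ s ∈ paths (proj₁ p) (proj₂ p) c)
      (sym (endpoint-∷ʳ (0 , 0) ss s)) (sym (countE-∷ʳ ss s))
      (∈-paths-∷ʳ s (proj₂ split) (go r (refl , proj₁ split , refl)))
    where
    split : All Above (points (0 , 0) ss) × Above (move (endpoint (0 , 0) ss) s)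
    split = ∷ʳ⁻ (subst (All Above) (points-∷ʳ (0 , 0) ss s) all-above)

paths-unique : ∀ x y j → Unique (paths x y j)
paths-unique zero    zero    zero    = [] ∷ []
paths-unique zero    zero    (suc j) = []
paths-unique zero    (suc y) j       = map-∷ʳ-unique N (paths-unique zero y j)
paths-unique (suc x) zero    j       = []
paths-unique (suc x) (suc y) j with 2 * suc x ≤? suc y
... | no  _ = []
... | yes _ = Unique.++⁺ (map-∷ʳ-unique E (last-E j))
                (Unique.++⁺ (map-∷ʳ-unique N (paths-unique (suc x) y j))
                            (map-∷ʳ-unique D (paths-unique x y j))
                            (map-∷ʳ-disjoint (λ ()) _ _))
                (disjoint-++ {ys = map (_∷ʳ N) (paths (suc x) y j)}
                  (map-∷ʳ-disjoint (λ ()) _ _) (map-∷ʳ-disjoint (λ ()) _ _))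
  where
  last-E : ∀ j → Unique (shift [] (paths x (suc y)) j)
  last-E zero    = []
  last-E (suc j) = paths-unique x (suc y) j

schr-enumerates : ∀ x y j → Fin (schr x y j) ↔ SchrPath x y j
schr-enumerates x y j =
  Fin-length↔Σ (paths-unique x y j) IsSchrPath-irrelevant (paths-sound x y j) paths-complete

schr-0 : ∀ y j → schr 0 y j ≡ 0 C j
schr-0 zero    zero    = refl
schr-0 zero    (suc j) = refl
schr-0 (suc y) j       = trans (length-map (_∷ʳ N) (paths 0 y j)) (schr-0 y j)

schr-below : ∀ {x y} → y < 2 * suc x → ∀ j → schr (suc x) y j ≡ 0
schr-below {x} {zero}  _    j = refl
schr-below {x} {suc y} y<2n j with 2 * suc x ≤? suc y
... | yes above = contradiction above (<⇒≱ y<2n)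
... | no  _     = refl

schr-step : ∀ {x y} → Above (suc x , suc y) → ∀ j →
  schr (suc x) (suc y) j ≡ shift 0 (schr x (suc y)) j + (schr (suc x) y j + schr x y j)
schr-step {x} {y} above j with 2 * suc x ≤? suc y
... | no  ¬above = contradiction above ¬above
... | yes _      = begin
    length (map (_∷ʳ E) PE ++ map (_∷ʳ N) PN ++ map (_∷ʳ D) PD)
  ≡⟨ length-++ (map (_∷ʳ E) PE) ⟩
    length (map (_∷ʳ E) PE) + length (map (_∷ʳ N) PN ++ map (_∷ʳ D) PD)
  ≡⟨ cong₂ _+_ (length-map (_∷ʳ E) PE) (length-++ (map (_∷ʳ N) PN)) ⟩
    length PE + (length (map (_∷ʳ N) PN) + length (map (_∷ʳ D) PD))
  ≡⟨ cong₂ (λ c d → length PE + (c + d)) (length-map (_∷ʳ N) PN) (length-map (_∷ʳ D) PD) ⟩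
    length PE + (length PN + length PD)
  ≡⟨ cong (_+ (length PN + length PD)) (length-shift j) ⟩
    shift 0 (schr x (suc y)) j + (length PN + length PD)
  ∎
  where
  PE = shift [] (paths x (suc y)) j
  PN = paths (suc x) y j
  PD = paths x y j
  length-shift : ∀ j → length (shift [] (paths x (suc y)) j) ≡ shift 0 (schr x (suc y)) j
  length-shift zero    = refl
  length-shift (suc j) = refl

schr-1 : ∀ k j → schr 1 (2 + k) j ≡ suc k * (1 C j)
schr-1 k j = begin
    schr 1 (2 + k) j
  ≡⟨ schr-step {0} {1 + k} (s≤s (s≤s z≤n)) j ⟩
    shift 0 (schr 0 (2 + k)) j + (schr 1 (1 + k) j + schr 0 (1 + k) j)
  ≡⟨ cong₂ (λ c d → c + (schr 1 (1 + k) j + d)) (shift-cong (schr-0 (2 + k)) j) (schr-0 (1 + k) j) ⟩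
    shift 0 (0 C_) j + (schr 1 (1 + k) j + 0 C j)
  ≡⟨ rearrange (shift 0 (0 C_) j) (schr 1 (1 + k) j) (0 C j) ⟩
    (shift 0 (0 C_) j + 0 C j) + schr 1 (1 + k) j
  ≡⟨ cong₂ _+_ (sym (pascal 0 j)) (lower k) ⟩
    suc k * (1 C j)
  ∎
  where
  rearrange : ∀ a b c → a + (b + c) ≡ (a + c) + b
  rearrange = solve-∀
  lower : ∀ k → schr 1 (1 + k) j ≡ k * (1 C j)
  lower zero    = schr-below {0} (s≤s (s≤s z≤n)) j
  lower (suc k) = schr-1 k j

-- lhs - rhs = U (n P - j (P + Q)) + (P + Q) ((2n + k + j) U - a (U + V)) with n = 1 + a,
-- which vanishes by the hypotheses; balanced is this identity with the negative terms moved across.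
closed-form-recurrence : ∀ a k j P Q U V →
  j * (P + Q) ≡ suc a * P → a * (U + V) ≡ (2 * suc a + k + j) * U →
  suc a * ((3 + k) * P * U) + a * (k * (P + Q) * V) + suc a * ((2 + k) * Q * U)
    ≡ a * ((1 + k) * (P + Q) * (U + V))
closed-form-recurrence a k j P Q U V hP hU =
  +-cancelʳ-≡ _ _ _ (begin
    lhs + (U * (j * (P + Q)) + (P + Q) * (a * (U + V)))
  ≡⟨ balanced a k j P Q U V ⟩
    rhs + (U * (suc a * P) + (P + Q) * ((2 * suc a + k + j) * U))
  ≡⟨ cong (rhs +_) (sym (cong₂ (λ p w → U * p + (P + Q) * w) hP hU)) ⟩
    rhs + (U * (j * (P + Q)) + (P + Q) * (a * (U + V)))
  ∎)
  where
  lhs = suc a * ((3 + k) * P * U) + a * (k * (P + Q) * V) + suc a * ((2 + k) * Q * U)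
  rhs = a * ((1 + k) * (P + Q) * (U + V))
  balanced : ∀ a k j P Q U V →
    suc a * ((3 + k) * P * U) + a * (k * (P + Q) * V) + suc a * ((2 + k) * Q * U)
      + (U * (j * (P + Q)) + (P + Q) * (a * (U + V)))
    ≡ a * ((1 + k) * (P + Q) * (U + V)) + (U * (suc a * P) + (P + Q) * ((2 * suc a + k + j) * U))
  balanced = solve-∀

-- Induction on n and, for fixed n, on k: the N-step term has the same n and k one smaller
-- (at k = 0 it sits just below the line), the E- and D-step terms have n - 1. Multiplying
-- by a = n - 1 puts all three in the form of the induction hypothesis.
schr-formula : ∀ a k {y} → y ≡ 2 * suc a + k → ∀ j →
  suc a * schr (suc a) y j ≡ suc k * (suc a C j) * ((y + j) C a)
schr-formula zero    k refl j = trans (+-identityʳ _) (trans (schr-1 k j) (sym (*-identityʳ _)))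
schr-formula (suc a) k {suc y} e j = *-cancelˡ-≡ _ _ (suc a) (begin
    suc a * (n * schr n (suc y) j)
  ≡⟨ cong (λ c → suc a * (n * c)) (schr-step above j) ⟩
    suc a * (n * (shift 0 (schr (suc a) (suc y)) j + (schr n y j + schr (suc a) y j)))
  ≡⟨ distribute (suc a) (shift 0 (schr (suc a) (suc y)) j) (schr n y j) (schr (suc a) y j) ⟩
    n * (suc a * shift 0 (schr (suc a) (suc y)) j) + suc a * (n * schr n y j)
      + n * (suc a * schr (suc a) y j)
  ≡⟨ cong₂ _+_ (cong₂ _+_ (cong (n *_) (last-E j)) (cong (suc a *_) (last-N k e))) (cong (n *_) last-D) ⟩
    n * ((3 + k) * P * U) + suc a * (k * (P + Q) * V) + n * ((2 + k) * Q * U)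
  ≡⟨ closed-form-recurrence (suc a) k j P Q U V hP hU ⟩
    suc a * ((1 + k) * (P + Q) * (U + V))
  ≡⟨ cong₂ (λ c d → suc a * (suc k * c * d))
           (sym (pascal (suc a) j)) (nCk+nC[k+1]≡[n+1]C[k+1] (y + j) a) ⟩
    suc a * (suc k * (n C j) * ((suc y + j) C suc a))
  ∎)
  where
  n = suc (suc a)
  P = shift 0 (suc a C_) j
  Q = suc a C j
  U = (y + j) C a
  V = (y + j) C suc a

  above : 2 * n ≤ suc y
  above = ≤-trans (m≤m+n (2 * n) k) (≤-reflexive (sym e))

  distribute : ∀ a E N D →
    a * (suc a * (E + (N + D))) ≡ suc a * (a * E) + a * (suc a * N) + suc a * (a * D)
  distribute = solve-∀

  E-height : ∀ a k → 2 * suc (suc a) + k ≡ 2 * suc a + (2 + k)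
  E-height = solve-∀

  last-E : ∀ j → suc a * shift 0 (schr (suc a) (suc y)) j ≡ (3 + k) * shift 0 (suc a C_) j * ((y + j) C a)
  last-E zero    = trans (*-zeroʳ (suc a)) (cong (_* ((y + 0) C a)) (sym (*-zeroʳ (3 + k))))
  last-E (suc j) = trans (schr-formula a (2 + k) (trans e (E-height a k)) j)
                         (cong (λ c → (3 + k) * (suc a C j) * (c C a)) (sym (+-suc y j)))

  last-N : ∀ k → suc y ≡ 2 * n + k → n * schr n y j ≡ k * (P + Q) * V
  last-N zero    e = trans (cong (n *_) (schr-below (≤-reflexive (trans e (+-identityʳ (2 * n)))) j))
                           (*-zeroʳ n)
  last-N (suc k) e = trans (schr-formula (suc a) k (suc-injective (trans e (+-suc (2 * n) k))) j)
                           (cong (λ c → suc k * c * V) (pascal (suc a) j))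

  D-height : ∀ a k → 2 * suc (suc a) + k ≡ suc (2 * suc a + suc k)
  D-height = solve-∀

  last-D : suc a * schr (suc a) y j ≡ (2 + k) * Q * U
  last-D = schr-formula a (suc k) (suc-injective (trans e (D-height a k))) j

  hP : j * (P + Q) ≡ n * P
  hP = trans (cong (j *_) (sym (pascal (suc a) j))) (absorption (suc a) j)

  hU : suc a * (U + V) ≡ (2 * n + k + j) * U
  hU = trans (cong (suc a *_) (nCk+nC[k+1]≡[n+1]C[k+1] (y + j) a))
             (trans (absorption (y + j) (suc a)) (cong (λ c → (c + j) * U) e))

theorem5 : (n m j : ℕ) → 1 ≤ n → j ≤ n → 2 * n ≤ m →
    Σ ℕ (λ S → (Fin S ↔ SchrPath n m j) ×
      (n * S ≡ (m ∸ 2 * n + 1) * (n C j) * ((m + j) C (n ∸ 1))))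
theorem5 (suc a) m j _ _ 2n≤m with m≤n⇒∃[o]m+o≡n 2n≤m
... | k , refl =
  schr n M j , schr-enumerates n M j ,
  trans (schr-formula a k refl j) (cong (λ c → c * (n C j) * ((M + j) C a)) (sym excess))
  where
  n = suc a
  M = 2 * n + k
  excess : M ∸ 2 * n + 1 ≡ suc k
  excess = trans (cong (_+ 1) (m+n∸m≡n (2 * n) k)) (+-comm k 1)
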